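{- Let $n$ be a positive integer, let $L$ be a set of graphs each having at most $n$ vertices, and let $S$ be a $(0,1)$-string. If the string $S^{2n-1}$ contains none of the graphs in $L$, then for every positive integer $k$ the graph associated with $S^k$ belongs to $\mathrm{Free}(L)$ (i.e. $S^k$ contains no graph in $L$).
   Context: All graphs are finite and simple. For a set $X$ of graphs, $\mathrm{Free}(X)$ is the class of graphs having no induced subgraph isomorphic to a member of $X$. A $(0,1)$-string is a finite sequence $s_1s_2\cdots s_k$ with each $s_i\in\{0,1\}$. For a string $S$, $S^k$ denotes the concatenation of $k$ copies of $S$. To a string $s_1\cdots s_k$ associate the graph with vertices $v_0,v_1,\dots,v_k$ in which, for each $i\in\{1,\dots,k\}$: if $s_i=0$ then $v_i$ is adjacent to $v_{i-1}$ and non-adjacent to all of $v_0,\dots,v_{i-2}$; if $s_i=1$ then $v_i$ is non-adjacent to $v_{i-1}$ and adjacent to all of $v_0,\dots,v_{i-2}$. A string $S$ contains a graph $G$ if $G$ is isomorphic to an induced subgraph of the graph associated with $S$. -}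

module Defs where

open import Data.Bool using (Bool; true; false; if_then_else_)
open import Data.Nat using (ℕ; zero; suc; _∸_; _<ᵇ_; _≡ᵇ_)
open import Data.Fin using (Fin; toℕ)
open import Data.List using (List; []; _∷_; length; concat; replicate)
open import Data.Product using (Σ; _×_)
open import Relation.Binary.PropositionalEquality using (_≡_)
open import Function.Definitions using (Injective)

record Graph : Set where
  field
    size   : ℕ
    adj    : Fin size → Fin size → Bool
    sym    : ∀ i j → adj i j ≡ adj j i
    irrefl : ∀ i → adj i i ≡ false
open Graph public

-- A (0,1)-string: false = 0, true = 1.
String01 : Set
String01 = List Bool

-- i-th entry (0-indexed); default false out of range (never used in range).
nth : List Bool → ℕ → Bool
nth []       _       = false
nth (b ∷ _)  zero    = b
nth (_ ∷ bs) (suc i) = nth bs i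

-- adjacency between v_i and v_j for i < j, in the graph of S:
-- s_j (the entry at 0-index j-1) decides.
--   s_j = 0 : adjacent iff i = j-1
--   s_j = 1 : adjacent iff i < j-1
edgeLt : String01 → ℕ → ℕ → Bool
edgeLt S i j = if nth S (j ∸ 1) then (suc i <ᵇ j) else (i ≡ᵇ (j ∸ 1))

edge : String01 → ℕ → ℕ → Bool
edge S i j = if i <ᵇ j then edgeLt S i j else (if j <ᵇ i then edgeLt S j i else false)

assocAdj : (S : String01) → Fin (suc (length S)) → Fin (suc (length S)) → Bool
assocAdj S x y = edge S (toℕ x) (toℕ y)

Contains : String01 → Graph → Set
Contains S G =
  Σ (Fin (size G) → Fin (suc (length S))) λ f →
    Injective _≡_ _≡_ f × (∀ i j → adj G i j ≡ assocAdj S (f i) (f j))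

_^ˢ_ : String01 → ℕ → String01
S ^ˢ k = concat (replicate k S)

-- In the graph of a string, the adjacency of v_a and v_b (a < b) depends only on whether
-- b = a + 1 and on the letter s_b. So an induced copy of H in S^k survives moving its vertices,
-- provided their order, which of them are consecutive and their residues mod |S| are kept.
-- Send the first vertex to its residue and replace every gap d between successive vertices by
-- a number of size at most |S| + 1 that is congruent to d and equals 1 iff d does. With at most
-- n vertices everything then lies below |S| + (n - 1)(|S| + 1) ≤ (2n - 1)|S|, inside S^(2n-1).
module Submission where

open import Defs hiding (sym)
open import Data.Bool using (true; false; not; T)
open import Data.Bool.Properties using (T-≡)
open import Data.Nat using (ℕ; zero; suc; _+_; _*_; _∸_; _≤_; _<_; _<ᵇ_; _≡ᵇ_; z≤n; s≤s; z<s; _<?_; _≟_; NonZero)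
open import Data.Nat.Properties
open import Data.Nat.DivMod using (_%_; _/_; m≡m%n+[m/n]*n; [m+kn]%n≡m%n; m%n<n; m<n⇒m%n≡m; m≤n⇒[n∸m]%m≡n%m)
open import Data.Nat.Induction using (<-rec)
open import Data.Nat.Tactic.RingSolver using (solve-∀)
open import Data.Fin using (Fin; toℕ; fromℕ<) renaming (zero to fzero; suc to fsuc)
open import Data.Fin.Properties using (any?; toℕ-injective; toℕ-fromℕ<; toℕ<n)
open import Data.List using ([]; _∷_; length; _++_)
open import Data.List.Properties using (length-++)
open import Data.Maybe using (Maybe; just; nothing)
open import Data.Product using (_×_; _,_; ∃)
open import Data.Sum using (inj₁; inj₂)
open import Function using (_∘_; Equivalence)
open import Function.Definitions using (Injective)
open import Relation.Nullary using (¬_; Dec; yes; no; contradiction)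
open import Relation.Binary using (tri<; tri≈; tri>)
open import Relation.Binary.PropositionalEquality
  using (_≡_; _≢_; refl; sym; trans; cong; cong₂; subst; module ≡-Reasoning)

¬T⇒≡false : ∀ {x} → ¬ T x → x ≡ false
¬T⇒≡false {false} _ = refl
¬T⇒≡false {true} ¬t = contradiction _ ¬t

<⇒<ᵇ≡true : ∀ {a b} → a < b → (a <ᵇ b) ≡ true
<⇒<ᵇ≡true a<b = Equivalence.to T-≡ (<⇒<ᵇ a<b)

≮⇒<ᵇ≡false : ∀ {a b} → ¬ a < b → (a <ᵇ b) ≡ false
≮⇒<ᵇ≡false {a} {b} a≮b = ¬T⇒≡false (a≮b ∘ <ᵇ⇒< a b)

≢⇒≡ᵇ≡false : ∀ {a b} → a ≢ b → (a ≡ᵇ b) ≡ false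
≢⇒≡ᵇ≡false {a} {b} a≢b = ¬T⇒≡false (a≢b ∘ ≡ᵇ⇒≡ a b)

≡ᵇ-refl : ∀ a → (a ≡ᵇ a) ≡ true
≡ᵇ-refl a = Equivalence.to T-≡ (≡⇒≡ᵇ a a refl)

edge-< : ∀ T {a b} → a < b → edge T a b ≡ edgeLt T a b
edge-< T a<b rewrite <⇒<ᵇ≡true a<b = refl

edge-> : ∀ T {a b} → b < a → edge T a b ≡ edgeLt T b a
edge-> T b<a rewrite ≮⇒<ᵇ≡false (<⇒≯ b<a) | <⇒<ᵇ≡true b<a = refl

edge-irrefl : ∀ T a → edge T a a ≡ false
edge-irrefl T a rewrite ≮⇒<ᵇ≡false (n≮n a) = refl

edgeLt-suc : ∀ T a → edgeLt T a (suc a) ≡ not (nth T a)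
edgeLt-suc T a rewrite ≮⇒<ᵇ≡false (n≮n a) | ≡ᵇ-refl a with nth T a
... | true = refl
... | false = refl

edgeLt-nonconsecutive : ∀ T {a b} → suc a < b → edgeLt T a b ≡ nth T (b ∸ 1)
edgeLt-nonconsecutive T {a} {suc b} (s≤s a<b)
  rewrite <⇒<ᵇ≡true a<b | ≢⇒≡ᵇ≡false (<⇒≢ a<b) with nth T b
... | true = refl
... | false = refl

record PreservesSpacing (φ : ℕ → ℕ) (a b : ℕ) : Set where
  field
    mono : φ a < φ b
    suc⇒ : b ≡ suc a → φ b ≡ suc (φ a)
    suc⇐ : φ b ≡ suc (φ a) → b ≡ suc a

edgeLt-transfer : ∀ T T' {φ a b} → a < b → PreservesSpacing φ a b →
                  nth T (b ∸ 1) ≡ nth T' (φ b ∸ 1) → edgeLt T a b ≡ edgeLt T' (φ a) (φ b)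
edgeLt-transfer T T' {φ} {a} {b} a<b sp letter with b ≟ suc a
... | yes refl = begin
  edgeLt T a (suc a)           ≡⟨ edgeLt-suc T a ⟩
  not (nth T a)                ≡⟨ cong not letter ⟩
  not (nth T' (φ (suc a) ∸ 1)) ≡⟨ cong (λ c → not (nth T' (c ∸ 1))) φb ⟩
  not (nth T' (φ a))           ≡⟨ edgeLt-suc T' (φ a) ⟨
  edgeLt T' (φ a) (suc (φ a))  ≡⟨ cong (edgeLt T' (φ a)) φb ⟨
  edgeLt T' (φ a) (φ (suc a))  ∎
  where
  open ≡-Reasoning
  φb = PreservesSpacing.suc⇒ sp refl
... | no b≢1+a = begin
  edgeLt T a b            ≡⟨ edgeLt-nonconsecutive T (≤∧≢⇒< a<b (b≢1+a ∘ sym)) ⟩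
  nth T (b ∸ 1)           ≡⟨ letter ⟩
  nth T' (φ b ∸ 1)        ≡⟨ edgeLt-nonconsecutive T' (≤∧≢⇒< mono (b≢1+a ∘ suc⇐ ∘ sym)) ⟨
  edgeLt T' (φ a) (φ b)   ∎
  where
  open ≡-Reasoning
  open PreservesSpacing sp

contains-transfer : ∀ T T' H (φ : ℕ → ℕ) (f : Fin (size H) → Fin (suc (length T))) →
  Injective _≡_ _≡_ f → (∀ i j → adj H i j ≡ assocAdj T (f i) (f j)) →
  (∀ i → φ (toℕ (f i)) ≤ length T') →
  (∀ i j → toℕ (f i) < toℕ (f j) → PreservesSpacing φ (toℕ (f i)) (toℕ (f j))) →
  (∀ i j → toℕ (f i) < toℕ (f j) → nth T (toℕ (f j) ∸ 1) ≡ nth T' (φ (toℕ (f j)) ∸ 1)) →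
  Contains T' H
contains-transfer T T' H φ f f-inj f-adj bounded spacing letter = f′ , f′-inj , f′-adj
  where
  p : Fin (size H) → ℕ
  p = toℕ ∘ f

  f′ : Fin (size H) → Fin (suc (length T'))
  f′ i = fromℕ< (s≤s (bounded i))

  toℕ-f′ : ∀ i → toℕ (f′ i) ≡ φ (p i)
  toℕ-f′ i = toℕ-fromℕ< (s≤s (bounded i))

  φ-injective : ∀ i j → φ (p i) ≡ φ (p j) → p i ≡ p j
  φ-injective i j e with <-cmp (p i) (p j)
  ... | tri< lt _ _ = contradiction e (<⇒≢ (PreservesSpacing.mono (spacing i j lt)))
  ... | tri≈ _ eq _ = eq
  ... | tri> _ _ gt = contradiction (sym e) (<⇒≢ (PreservesSpacing.mono (spacing j i gt)))

  f′-inj : Injective _≡_ _≡_ f′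
  f′-inj {i} {j} e =
    f-inj (toℕ-injective (φ-injective i j (trans (sym (toℕ-f′ i)) (trans (cong toℕ e) (toℕ-f′ j)))))

  edge-transfer : ∀ i j → edge T (p i) (p j) ≡ edge T' (φ (p i)) (φ (p j))
  edge-transfer i j with <-cmp (p i) (p j)
  ... | tri< lt _ _ = trans (edge-< T lt)
                        (trans (edgeLt-transfer T T' lt (spacing i j lt) (letter i j lt))
                               (sym (edge-< T' (PreservesSpacing.mono (spacing i j lt)))))
  ... | tri> _ _ gt = trans (edge-> T gt)
                        (trans (edgeLt-transfer T T' gt (spacing j i gt) (letter j i gt))
                               (sym (edge-> T' (PreservesSpacing.mono (spacing j i gt)))))
  ... | tri≈ _ eq _ rewrite eq = trans (edge-irrefl T (p j)) (sym (edge-irrefl T' (φ (p j))))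

  f′-adj : ∀ i j → adj H i j ≡ assocAdj T' (f′ i) (f′ j)
  f′-adj i j =
    trans (f-adj i j) (trans (edge-transfer i j) (sym (cong₂ (edge T') (toℕ-f′ i) (toℕ-f′ j))))

shrinkGap : (m : ℕ) .{{_ : NonZero m}} → ℕ → ℕ
shrinkGap m zero = zero
shrinkGap m (suc zero) = suc zero
shrinkGap m (suc (suc d)) = suc (suc (d % m))

module _ (m : ℕ) .{{_ : NonZero m}} where

  shrinkGap-≡-mod : ∀ d → ∃ λ t → d ≡ shrinkGap m d + t * m
  shrinkGap-≡-mod zero = 0 , refl
  shrinkGap-≡-mod (suc zero) = 0 , refl
  shrinkGap-≡-mod (suc (suc d)) = d / m , cong (suc ∘ suc) (m≡m%n+[m/n]*n d m)

  shrinkGap-≤ : ∀ d → shrinkGap m d ≤ suc m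
  shrinkGap-≤ zero = z≤n
  shrinkGap-≤ (suc zero) = s≤s z≤n
  shrinkGap-≤ (suc (suc d)) = s≤s (m%n<n d m)

  shrinkGap-pos : ∀ {d} → 0 < d → 0 < shrinkGap m d
  shrinkGap-pos {suc zero} _ = s≤s z≤n
  shrinkGap-pos {suc (suc d)} _ = s≤s z≤n

  shrinkGap≡1⇒≡1 : ∀ {d} → shrinkGap m d ≡ 1 → d ≡ 1
  shrinkGap≡1⇒≡1 {suc zero} _ = refl

countBelow : ∀ {s} → (Fin s → ℕ) → ℕ → ℕ
countBelow {zero} p y = 0
countBelow {suc s} p y with p fzero <? y
... | yes _ = suc (countBelow (p ∘ fsuc) y)
... | no _ = countBelow (p ∘ fsuc) y

countBelow-≤ : ∀ {s} (p : Fin s → ℕ) y → countBelow p y ≤ s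
countBelow-≤ {zero} p y = z≤n
countBelow-≤ {suc s} p y with p fzero <? y
... | yes _ = s≤s (countBelow-≤ (p ∘ fsuc) y)
... | no _ = m≤n⇒m≤1+n (countBelow-≤ (p ∘ fsuc) y)

countBelow-mono : ∀ {s} (p : Fin s → ℕ) {x y} → x ≤ y → countBelow p x ≤ countBelow p y
countBelow-mono {zero} p x≤y = z≤n
countBelow-mono {suc s} p {x} {y} x≤y with p fzero <? x | p fzero <? y
... | yes _ | yes _ = s≤s (countBelow-mono (p ∘ fsuc) x≤y)
... | yes p₀<x | no p₀≮y = contradiction (<-≤-trans p₀<x x≤y) p₀≮y
... | no _ | yes _ = m≤n⇒m≤1+n (countBelow-mono (p ∘ fsuc) x≤y)
... | no _ | no _ = countBelow-mono (p ∘ fsuc) x≤y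

countBelow-< : ∀ {s} (p : Fin s → ℕ) {x y} i → x ≤ p i → p i < y → countBelow p x < countBelow p y
countBelow-< {suc s} p {x} {y} fzero x≤p₀ p₀<y with p fzero <? x | p fzero <? y
... | yes p₀<x | _ = contradiction x≤p₀ (<⇒≱ p₀<x)
... | no _ | no p₀≮y = contradiction p₀<y p₀≮y
... | no _ | yes _ = s≤s (countBelow-mono (p ∘ fsuc) (≤-trans x≤p₀ (<⇒≤ p₀<y)))
countBelow-< {suc s} p {x} {y} (fsuc i) x≤pᵢ pᵢ<y with p fzero <? x | p fzero <? y
... | yes _ | yes _ = s≤s (countBelow-< (p ∘ fsuc) i x≤pᵢ pᵢ<y)
... | yes p₀<x | no p₀≮y = contradiction (<-≤-trans p₀<x (≤-trans x≤pᵢ (<⇒≤ pᵢ<y))) p₀≮y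
... | no _ | yes _ = m<n⇒m<1+n (countBelow-< (p ∘ fsuc) i x≤pᵢ pᵢ<y)
... | no _ | no _ = countBelow-< (p ∘ fsuc) i x≤pᵢ pᵢ<y

-- The first occupied position is sent to its residue mod m, and every later one to the image
-- of its predecessor plus the shrunk gap. 'anchor y' is the last occupied position below y
-- together with its image, which makes this definable by structural recursion.
module Compression (m : ℕ) .{{_ : NonZero m}} {s : ℕ} (p : Fin s → ℕ) where

  Occupied : ℕ → Set
  Occupied y = ∃ λ i → p i ≡ y

  place : ℕ → Maybe (ℕ × ℕ) → ℕ
  place y nothing = y % m
  place y (just (q , g)) = g + shrinkGap m (y ∸ q)

  advance : ∀ y → Dec (Occupied y) → Maybe (ℕ × ℕ) → Maybe (ℕ × ℕ)
  advance y (yes _) o = just (y , place y o)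
  advance y (no _) o = o

  anchor : ℕ → Maybe (ℕ × ℕ)
  anchor zero = nothing
  anchor (suc y) = advance y (any? (λ i → p i ≟ y)) (anchor y)

  compress : ℕ → ℕ
  compress y = place y (anchor y)

  IsAnchor : ℕ → Maybe (ℕ × ℕ) → Set
  IsAnchor y nothing = ∀ i → y ≤ p i
  IsAnchor y (just (q , g)) = q < y × Occupied q × (∀ i → p i < y → p i ≤ q) × g ≡ compress q

  IsAnchor-skip : ∀ {y} o → ¬ Occupied y → IsAnchor y o → IsAnchor (suc y) o
  IsAnchor-skip nothing free below i = ≤∧≢⇒< (below i) (free ∘ (i ,_) ∘ sym)
  IsAnchor-skip (just _) free (q<y , occ , maximal , g≡) =
    m≤n⇒m≤1+n q<y , occ , (λ i pᵢ<1+y → maximal i (≤∧≢⇒< (≤-pred pᵢ<1+y) (free ∘ (i ,_)))) , g≡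

  anchor-correct : ∀ y → IsAnchor y (anchor y)
  anchor-correct zero i = z≤n
  anchor-correct (suc y) = advance-correct (any? (λ i → p i ≟ y))
    where
    advance-correct : ∀ d → IsAnchor (suc y) (advance y d (anchor y))
    advance-correct (yes occ) = ≤-refl , occ , (λ i → ≤-pred) , refl
    advance-correct (no free) = IsAnchor-skip (anchor y) free (anchor-correct y)

  data CompressView (b : ℕ) : Set where
    first : (∀ i → b ≤ p i) → compress b ≡ b % m → CompressView b
    after : ∀ q → q < b → Occupied q → (∀ i → p i < b → p i ≤ q) →
            compress b ≡ compress q + shrinkGap m (b ∸ q) → CompressView b

  compress-view : ∀ b → CompressView b
  compress-view b with anchor b in eq | anchor-correct b
  ... | nothing | below = first below (cong (place b) eq)
  ... | just (q , g) | q<b , occ , maximal , g≡ =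
    after q q<b occ maximal (trans (cong (place b) eq) (cong (_+ _) g≡))

  compress-≡-mod : ∀ b → ∃ λ t → b ≡ compress b + t * m
  compress-≡-mod = <-rec _ go
    where
    go : ∀ b → (∀ {q} → q < b → ∃ λ t → q ≡ compress q + t * m) → ∃ λ t → b ≡ compress b + t * m
    go b rec with compress-view b
    ... | first _ eq = b / m , trans (m≡m%n+[m/n]*n b m) (cong (_+ b / m * m) (sym eq))
    ... | after q q<b _ _ eq with rec q<b | shrinkGap-≡-mod m (b ∸ q)
    ...   | t , q≡ | u , gap≡ = t + u , (begin
      b                                                      ≡⟨ m+[n∸m]≡n (<⇒≤ q<b) ⟨
      q + (b ∸ q)                                            ≡⟨ cong₂ _+_ q≡ gap≡ ⟩
      (compress q + t * m) + (shrinkGap m (b ∸ q) + u * m)   ≡⟨ regroup (compress q) _ t u m ⟩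
      (compress q + shrinkGap m (b ∸ q)) + (t + u) * m       ≡⟨ cong (_+ (t + u) * m) eq ⟨
      compress b + (t + u) * m                               ∎)
      where
      open ≡-Reasoning
      regroup : ∀ x y t u m → (x + t * m) + (y + u * m) ≡ (x + y) + (t + u) * m
      regroup = solve-∀

  compress-< : ∀ b → compress b < m + countBelow p b * suc m
  compress-< = <-rec _ go
    where
    go : ∀ b → (∀ {q} → q < b → compress q < m + countBelow p q * suc m) →
         compress b < m + countBelow p b * suc m
    go b rec with compress-view b
    ... | first _ eq = subst (_< m + countBelow p b * suc m) (sym eq) (<-≤-trans (m%n<n b m) (m≤m+n m _))
    ... | after q q<b (i , pᵢ≡q) _ eq = begin-strict
      compress b                                ≡⟨ eq ⟩
      compress q + shrinkGap m (b ∸ q)          <⟨ +-mono-<-≤ (rec q<b) (shrinkGap-≤ m (b ∸ q)) ⟩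
      (m + countBelow p q * suc m) + suc m      ≡⟨ +-assoc m _ (suc m) ⟩
      m + (countBelow p q * suc m + suc m)      ≡⟨ cong (m +_) (+-comm _ (suc m)) ⟩
      m + suc (countBelow p q) * suc m          ≤⟨ +-monoʳ-≤ m (*-monoˡ-≤ (suc m) more-below-b) ⟩
      m + countBelow p b * suc m                ∎
      where
      open ≤-Reasoning
      more-below-b : countBelow p q < countBelow p b
      more-below-b = countBelow-< p i (≤-reflexive (sym pᵢ≡q)) (subst (_< b) (sym pᵢ≡q) q<b)

  compress-anchor-< : ∀ {q b} → q < b → compress b ≡ compress q + shrinkGap m (b ∸ q) →
                      compress q < compress b
  compress-anchor-< {q} q<b eq =
    subst (compress q <_) (sym eq) (m<m+n (compress q) (shrinkGap-pos m (m<n⇒0<n∸m q<b)))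

  occupied-not-first : ∀ {a b} → Occupied a → a < b → ¬ (∀ i → b ≤ p i)
  occupied-not-first (i , refl) a<b below = <⇒≱ a<b (below i)

  occupied-≤-anchor : ∀ {a b q} → Occupied a → a < b → (∀ i → p i < b → p i ≤ q) → a ≤ q
  occupied-≤-anchor (i , refl) a<b maximal = maximal i a<b

  compress-mono : ∀ {a} b → Occupied a → a < b → compress a < compress b
  compress-mono {a} = <-rec _ go
    where
    go : ∀ b → (∀ {q} → q < b → Occupied a → a < q → compress a < compress q) →
         Occupied a → a < b → compress a < compress b
    go b rec occ a<b with compress-view b
    ... | first below _ = contradiction below (occupied-not-first occ a<b)
    ... | after q q<b _ maximal eq with m≤n⇒m<n∨m≡n (occupied-≤-anchor occ a<b maximal)
    ...   | inj₁ a<q = <-trans (rec q<b occ a<q) (compress-anchor-< q<b eq)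
    ...   | inj₂ refl = compress-anchor-< q<b eq

  compress-spacing : ∀ {a b} → Occupied a → a < b → PreservesSpacing compress a b
  compress-spacing {a} {b} occ a<b with compress-view b
  ... | first below _ = contradiction below (occupied-not-first occ a<b)
  ... | after q q<b _ maximal eq with m≤n⇒m<n∨m≡n (occupied-≤-anchor occ a<b maximal)
  ...   | inj₁ a<q = record
    { mono = compress-mono b occ a<b
    ; suc⇒ = λ b≡1+a → contradiction (≤-pred (subst (q <_) b≡1+a q<b)) (<⇒≱ a<q)
    ; suc⇐ = λ e → contradiction (≤-pred (subst (compress q <_) e (compress-anchor-< q<b eq)))
                                 (<⇒≱ (compress-mono q occ a<q))
    }
  ...   | inj₂ refl = record
    { mono = compress-anchor-< q<b eq
    ; suc⇒ = λ { refl → trans eq (trans (cong (λ d → compress a + shrinkGap m d) (m+n∸n≡m 1 a))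
                                        (+-comm (compress a) 1)) }
    ; suc⇐ = λ e → begin
        b             ≡⟨ m+[n∸m]≡n (<⇒≤ a<b) ⟨
        a + (b ∸ a)   ≡⟨ cong (a +_) (gap≡1 e) ⟩
        a + 1         ≡⟨ +-comm a 1 ⟩
        suc a         ∎
    }
    where
    open ≡-Reasoning
    gap≡1 : compress b ≡ suc (compress a) → b ∸ a ≡ 1
    gap≡1 e = shrinkGap≡1⇒≡1 m (+-cancelˡ-≡ (compress a) _ 1 (trans (sym eq) (trans e (+-comm 1 _))))

nth-++-< : ∀ A T {y} → y < length A → nth (A ++ T) y ≡ nth A y
nth-++-< (_ ∷ A) T {zero} _ = refl
nth-++-< (_ ∷ A) T {suc y} (s≤s y<∣A∣) = nth-++-< A T y<∣A∣

nth-++-≥ : ∀ A T {y} → length A ≤ y → nth (A ++ T) y ≡ nth T (y ∸ length A)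
nth-++-≥ [] T _ = refl
nth-++-≥ (_ ∷ A) T {suc y} (s≤s ∣A∣≤y) = nth-++-≥ A T ∣A∣≤y

length-^ˢ : ∀ S k → length (S ^ˢ k) ≡ k * length S
length-^ˢ S zero = refl
length-^ˢ S (suc k) = trans (length-++ S) (cong (length S +_) (length-^ˢ S k))

[]-^ˢ : ∀ k → [] ^ˢ k ≡ []
[]-^ˢ zero = refl
[]-^ˢ (suc k) = []-^ˢ k

compressed-length-≤ : ∀ m .{{_ : NonZero m}} {c n} → c < n → m + c * suc m ≤ (2 * n ∸ 1) * m
compressed-length-≤ m {c} {n} c<n = begin
  m + c * suc m           ≡⟨ cong (m +_) (*-suc c m) ⟩
  m + (c + c * m)         ≤⟨ +-monoʳ-≤ m (+-monoˡ-≤ (c * m) (m≤m*n c m)) ⟩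
  m + (c * m + c * m)     ≡⟨ double c m ⟩
  suc (2 * c) * m         ≡⟨ cong (λ x → (x ∸ 1) * m) (*-suc 2 c) ⟨
  (2 * suc c ∸ 1) * m     ≤⟨ *-monoˡ-≤ m (∸-monoˡ-≤ 1 (*-monoʳ-≤ 2 c<n)) ⟩
  (2 * n ∸ 1) * m         ∎
  where
  open ≤-Reasoning
  double : ∀ c m → m + (c * m + c * m) ≡ suc (2 * c) * m
  double = solve-∀

module Power (S : String01) .{{_ : NonZero (length S)}} where

  nth-^ˢ : ∀ k {y} → y < length (S ^ˢ k) → nth (S ^ˢ k) y ≡ nth S (y % length S)
  nth-^ˢ (suc k) {y} y<∣Sᵏ⁺¹∣ with y <? length S
  ... | yes y<∣S∣ = trans (nth-++-< S _ y<∣S∣) (cong (nth S) (sym (m<n⇒m%n≡m y<∣S∣)))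
  ... | no y≮∣S∣ = begin
    nth (S ++ S ^ˢ k) y               ≡⟨ nth-++-≥ S _ ∣S∣≤y ⟩
    nth (S ^ˢ k) (y ∸ length S)       ≡⟨ nth-^ˢ k y∸∣S∣< ⟩
    nth S ((y ∸ length S) % length S) ≡⟨ cong (nth S) (m≤n⇒[n∸m]%m≡n%m ∣S∣≤y) ⟩
    nth S (y % length S)              ∎
    where
    open ≡-Reasoning
    ∣S∣≤y = ≮⇒≥ y≮∣S∣
    y∸∣S∣< : y ∸ length S < length (S ^ˢ k)
    y∸∣S∣< = subst (y ∸ length S <_) (m+n∸m≡n (length S) _)
               (∸-monoˡ-< (subst (y <_) (length-++ S) y<∣Sᵏ⁺¹∣) ∣S∣≤y)

  nth-^ˢ-periodic : ∀ k k′ {x y} t → x < length (S ^ˢ k) → y < length (S ^ˢ k′) →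
                    x ≡ y + t * length S → nth (S ^ˢ k) x ≡ nth (S ^ˢ k′) y
  nth-^ˢ-periodic k k′ {x} {y} t x< y< x≡ = begin
    nth (S ^ˢ k) x                          ≡⟨ nth-^ˢ k x< ⟩
    nth S (x % length S)                    ≡⟨ cong (λ z → nth S (z % length S)) x≡ ⟩
    nth S ((y + t * length S) % length S)   ≡⟨ cong (nth S) ([m+kn]%n≡m%n y t (length S)) ⟩
    nth S (y % length S)                    ≡⟨ nth-^ˢ k′ y< ⟨
    nth (S ^ˢ k′) y                         ∎
    where open ≡-Reasoning

  contains-shorter-power : ∀ n k H → size H ≤ n → Contains (S ^ˢ k) H → Contains (S ^ˢ (2 * n ∸ 1)) H
  contains-shorter-power n k H size≤n (f , f-inj , f-adj) =
    contains-transfer (S ^ˢ k) (S ^ˢ (2 * n ∸ 1)) H compress f f-inj f-adj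
                      bounded (λ i j → compress-spacing (i , refl)) letter
    where
    p : Fin (size H) → ℕ
    p = toℕ ∘ f

    open Compression (length S) p

    bounded : ∀ i → compress (p i) ≤ length (S ^ˢ (2 * n ∸ 1))
    bounded i = begin
      compress (p i)                                   ≤⟨ <⇒≤ (compress-< (p i)) ⟩
      length S + countBelow p (p i) * suc (length S)   ≤⟨ compressed-length-≤ (length S) fewer-than-n ⟩
      (2 * n ∸ 1) * length S                           ≡⟨ length-^ˢ S (2 * n ∸ 1) ⟨
      length (S ^ˢ (2 * n ∸ 1))                        ∎
      where
      open ≤-Reasoning
      fewer-than-n : countBelow p (p i) < n
      fewer-than-n =
        <-≤-trans (countBelow-< p i ≤-refl (n<1+n (p i))) (≤-trans (countBelow-≤ p _) size≤n)

    letter : ∀ i j → p i < p j → nth (S ^ˢ k) (p j ∸ 1) ≡ nth (S ^ˢ (2 * n ∸ 1)) (compress (p j) ∸ 1)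
    letter i j pᵢ<pⱼ with compress-≡-mod (p j)
    ... | t , pⱼ≡ = nth-^ˢ-periodic k (2 * n ∸ 1) {p j ∸ 1} {compress (p j) ∸ 1} t
                      (∸-monoˡ-< (toℕ<n (f j)) (<-≤-trans z<s pᵢ<pⱼ))
                      (∸-monoˡ-< (s≤s (bounded j)) 0<compress)
                      (trans (cong (_∸ 1) pⱼ≡) (+-∸-comm (t * length S) 0<compress))
      where
      0<compress : 0 < compress (p j)
      0<compress = <-≤-trans z<s (PreservesSpacing.mono (compress-spacing (i , refl) pᵢ<pⱼ))

contains-shorter-power : ∀ S n k H → size H ≤ n → Contains (S ^ˢ k) H → Contains (S ^ˢ (2 * n ∸ 1)) H
contains-shorter-power [] n k H _ =
  subst (λ T → Contains T H) (trans ([]-^ˢ k) (sym ([]-^ˢ (2 * n ∸ 1))))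
contains-shorter-power S@(_ ∷ _) = Power.contains-shorter-power S

lemma3p3 : (n : ℕ) → 1 ≤ n → (L : Graph → Set) → (∀ G → L G → size G ≤ n) →
           (S : String01) → (∀ G → L G → ¬ Contains (S ^ˢ (2 * n ∸ 1)) G) →
           (k : ℕ) → 1 ≤ k → ∀ G → L G → ¬ Contains (S ^ˢ k) G
lemma3p3 n _ L small S avoids k _ G G∈L = avoids G G∈L ∘ contains-shorter-power S n k G (small G G∈L)
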